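{- Consider Algorithm L (defined in the context) run on a tree network with half-duplex links and $k$ agents, exactly one of which is the leader. Starting from an arbitrary initial configuration, a legitimate configuration is eventually reached.
   Context: Model. The network is a finite tree with half-duplex links: two agents at neighbouring nodes cannot cross the same edge in opposite directions in the same step. Ports at a node of degree $\delta$ are $0,\dots,\delta-1$. There are $k$ agents; exactly one carries a special leader mark, recognizable by nodes and not in the domain of non-leader identifiers. Each non-leader agent holds an integer $\mathtt{id}$. Each node's whiteboard holds a single port variable $\mathtt{edge}$. The scheduler repeatedly chooses a set of nodes hosting at least one agent. An activated node first executes the code of each non-leader agent it hosts, sequentially, and then the code of the leader if present. The scheduler is fair: every node hosting an agent is eventually activated. Self-stabilizing setting. Initially, non-leader identifiers, agent positions and whiteboard contents are arbitrary. Algorithm L. At a node of degree $\delta$ with whiteboard variable $\mathtt{edge}$: - The leader sets $\mathtt{edge}:=(\mathtt{edge}+1)\bmod\delta$ and leaves through port $\mathtt{edge}$. - A non-leader agent, if the leader is at the same node, first replaces its $\mathtt{id}$ by a fresh identifier if its $\mathtt{id}$ is shared by another agent present at the node; it then leaves through port $(\mathtt{edge}+1)\bmod\delta$, which is the same exit the leader will take. - A non-leader agent, if the leader is not at the same node, leaves through port $\mathtt{edge}$. Legitimate configuration. A configuration is legitimate if all three of the following hold: (i) all non-leader agents have pairwise distinct identifiers; (ii) all agents are located at the same node; (iii) every whiteboard's $\mathtt{edge}$ points toward the node containing all agents. -}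

module Defs where

open import Data.Nat using (ℕ; zero; suc; _<_; _≤_; _%_)
open import Data.Nat.DivMod using (m%n<n)
open import Data.Integer using (ℤ)
open import Data.Fin using (Fin; toℕ; fromℕ<; _≟_)
open import Data.Fin.Subset using (Subset; _∈_; _∉_)
open import Data.List using (List; []; _∷_; _++_; length)
open import Data.List.Relation.Unary.Linked using (Linked)
open import Data.List.Relation.Unary.Unique.Propositional using (Unique)
open import Data.Product using (Σ; ∃; _×_; _,_)
open import Data.Sum using (_⊎_)
open import Data.Empty using (⊥)
open import Relation.Nullary using (¬_; yes; no)
open import Relation.Binary.PropositionalEquality using (_≡_; _≢_)
open import Relation.Binary.Construct.Closure.ReflexiveTransitive using (Star)
open import Function.Definitions using (Injective)

record PortGraph (n : ℕ) : Set where
  field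
    deg : Fin n → ℕ
    nbr : (v : Fin n) → Fin (deg v) → Fin n

module _ {n : ℕ} (G : PortGraph n) where
  open PortGraph G

  Adj : Fin n → Fin n → Set
  Adj u v = ∃ λ (p : Fin (deg u)) → nbr u p ≡ v

  SimplePath : List (Fin n) → Set
  SimplePath xs = Unique xs × Linked Adj xs

  -- a cycle x ∷ ys (x ∷ ys ++ [x] is a closed walk) of length ≥ 3
  -- through pairwise distinct nodes
  IsCycle : Fin n → List (Fin n) → Set
  IsCycle x ys = (2 ≤ length ys) × Unique (x ∷ ys) × Linked Adj (x ∷ ys ++ x ∷ [])

record Tree (n : ℕ) : Set where
  field
    graph      : PortGraph n
  open PortGraph graph public
  field
    nbr-inj    : ∀ v → Injective _≡_ _≡_ (nbr v)
    no-loop    : ∀ v p → nbr v p ≢ v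
    symmetric  : ∀ v p → Adj graph (nbr v p) v
    connected  : ∀ u v → Star (Adj graph) u v
    acyclic    : ∀ x ys → ¬ IsCycle graph x ys

lastOf : ∀ {A : Set} → A → List A → A
lastOf x []       = x
lastOf x (y ∷ ys) = lastOf y ys

nextPort : ∀ {d} → Fin d → Fin d
nextPort {suc d} i = fromℕ< (m%n<n (suc (toℕ i)) (suc d))

-- Configurations: one leader, m non-leaders (k = m + 1 agents)

data Agent (m : ℕ) : Set where
  leader    : Agent m
  nonLeader : Fin m → Agent m

module _ {n : ℕ} (T : Tree n) (m : ℕ) where
  open Tree T

  record Config : Set where
    field
      leaderPos : Fin n
      pos       : Fin m → Fin n
      ident     : Fin m → ℤ
      edge      : (v : Fin n) → Fin (deg v)  -- whiteboards

  open Config public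

module _ {n : ℕ} (T : Tree n) {m : ℕ} where
  open Tree T

  at : Config T m → Agent m → Fin n
  at c leader        = leaderPos c
  at c (nonLeader i) = pos c i

  exitPort : (c : Config T m) (a : Agent m) → Fin (deg (at c a))
  exitPort c leader        = nextPort (edge c (leaderPos c))
  exitPort c (nonLeader i) with leaderPos c ≟ pos c i
  ... | yes _ = nextPort (edge c (pos c i))
  ... | no  _ = edge c (pos c i)

  dest : Config T m → Agent m → Fin n
  dest c a = nbr (at c a) (exitPort c a)

  Hosts : Config T m → Fin n → Set
  Hosts c v = ∃ λ (a : Agent m) → at c a ≡ v

  Crosses : Config T m → Subset n → Agent m → Fin n → Fin n → Set
  Crosses c S a u v = (at c a ≡ u) × (u ∈ S) × (dest c a ≡ v)

  -- the scheduler's choice: a nonempty set of nodes each hosting an agent,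
  -- respecting half-duplex links
  ValidChoice : Config T m → Subset n → Set
  ValidChoice c S =
    (∃ λ v → v ∈ S) ×
    (∀ v → v ∈ S → Hosts c v) ×
    (∀ a b u v → Crosses c S a u v → Crosses c S b v u → ⊥)

  -- rank gives the order in which non-leaders are executed at their node
  -- (smaller rank executes first); an agent with larger rank has not left yet.
  SharedId : Config T m → (Fin m → ℕ) → Fin m → Set
  SharedId c rank i = ∃ λ j → (j ≢ i) × (pos c j ≡ pos c i) × (rank i < rank j) × (ident c j ≡ ident c i)

  Renames : Config T m → Subset n → (Fin m → ℕ) → Fin m → Set
  Renames c S rank i = (pos c i ∈ S) × (leaderPos c ≡ pos c i) × SharedId c rank i

  Fresh : Config T m → Config T m → Fin m → ℤ → Set
  Fresh c c′ i x = ∀ j → j ≢ i → (x ≢ ident c j) × (x ≢ ident c′ j)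

  Step : Config T m → Subset n → (Fin m → ℕ) → Config T m → Set
  Step c S rank c′ =
    (∀ a → at c a ∈ S → at c′ a ≡ dest c a) ×
    (∀ a → at c a ∉ S → at c′ a ≡ at c a) ×
    (∀ v → v ∈ S → leaderPos c ≡ v → edge c′ v ≡ nextPort (edge c v)) ×
    (∀ v → ¬ (v ∈ S × leaderPos c ≡ v) → edge c′ v ≡ edge c v) ×
    (∀ i → Renames c S rank i → Fresh c c′ i (ident c′ i)) ×
    (∀ i → ¬ Renames c S rank i → ident c′ i ≡ ident c i)

  record Execution : Set where
    field
      config : ℕ → Config T m
      sched  : ℕ → Subset n
      rank   : ℕ → Fin m → ℕ
      rank-inj : ∀ t → Injective _≡_ _≡_ (rank t)
      valid  : ∀ t → ValidChoice (config t) (sched t)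
      step   : ∀ t → Step (config t) (sched t) (rank t) (config (suc t))
      fair   : ∀ t v → Hosts (config t) v → ∃ λ t′ → (t ≤ t′) × (v ∈ sched t′)

  PointsToward : (v : Fin n) → Fin (deg v) → Fin n → Set
  PointsToward v p r = ∃ λ zs → SimplePath graph (v ∷ nbr v p ∷ zs) × (r ≡ lastOf (nbr v p) zs)

  Legitimate : Config T m → Set
  Legitimate c =
    (∀ i j → i ≢ j → ident c i ≢ ident c j) ×
    (∃ λ r → (∀ a → at c a ≡ r) ×
             (∀ v → v ≢ r → PointsToward v (edge c v) r))

module Submission where

-- In a tree a simple path from L extends by a neighbour w of L unless it already
-- continues through w (`extend`); hence simple paths with equal ends coincide
-- (`path-unique`) and have at most n nodes.  The leader is a rotor-router walk:
-- each departure from v rotates v's whiteboard, so deg v successive departures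
-- from v use every port; with fairness, K·deg v departures from v force K
-- departures from each neighbour (`spread`).  A pigeonhole count yields a node
-- departed from arbitrarily often, so by connectivity the leader visits every
-- node (`leader-visits`), after which that node's whiteboard points toward the
-- leader forever (`oriented-step`).  Then each non-leader walks toward the leader
-- along the unique path; the part of a leader-path beyond it grows at each move
-- but has fewer than n nodes, so it joins the leader (`chase`) for good.  At the
-- next activation of the leader's node all agents leave together and duplicate
-- identifiers are refreshed: the configuration is legitimate (`legitimate-next`).

open import Defs
open import Data.Nat using (ℕ; zero; suc; _+_; _*_; _∸_; _≤_; _<_; _≤′_; z≤n; s≤s; _<?_; _⊔_; _%_)
open import Data.Nat.Properties
  using (module ≤-Reasoning; ≤-refl; ≤-trans; <-irrefl; ≤-<-trans; <-≤-trans; n≤1+n; ≮⇒≥; <⇒≱;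
         m≤n+m; ≤′⇒≤; ≤⇒≤′; m≤n⇒m<n∨m≡n; m≤m⊔n; m≤n⊔m; +-suc; +-comm; +-assoc; +-identityʳ;
         +-mono-≤; +-monoˡ-≤; m∸n+n≡m; <-cmp; +-0-commutativeMonoid)
open import Data.Nat.DivMod using (m%n<n; m≤n⇒m%n≡m; [m+n]%n≡m%n; m%n%n≡m%n; %-distribˡ-+)
open import Data.Nat.GeneralisedArithmetic using (iterate)
open import Data.Fin using (Fin; toℕ; _≟_) renaming (zero to fzero; suc to fsuc)
open import Data.Fin.Properties using (toℕ-injective; toℕ-fromℕ<; toℕ≤pred[n]; injective⇒≤; any?)
open import Data.Fin.Subset using (Subset; _∈_; _∉_)
open import Data.Fin.Subset.Properties using (_∈?_)
open import Data.List using (List; []; _∷_; _++_; _ʳ++_; length; lookup)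
open import Data.List.Properties using (++-assoc; ∷-injective; ++-ʳ++; length-++)
open import Data.List.Relation.Unary.All as All using (All; []; _∷_)
open import Data.List.Relation.Unary.All.Properties using (¬Any⇒All¬)
open import Data.List.Relation.Unary.Any using (here; there)
open import Data.List.Relation.Unary.AllPairs using ([]; _∷_)
open import Data.List.Relation.Unary.Linked as Linked using (Linked; []; [-]; _∷_)
open import Data.List.Relation.Unary.Unique.Propositional using (Unique)
open import Data.List.Relation.Unary.Unique.Propositional.Properties using (Unique[x∷xs]⇒x∉xs)
open import Data.List.Membership.Propositional using () renaming (_∈_ to _∈ₗ_; _∉_ to _∉ₗ_)
open import Data.List.Membership.Propositional.Properties using (∈-++⁺ʳ; ∈-∃++; ∈-lookup)
open import Data.List.Membership.DecPropositional using () renaming (_∈?_ to member?)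
open import Data.Product using (∃; _×_; _,_; proj₁; proj₂)
open import Data.Sum as Sum using (_⊎_; inj₁; inj₂)
open import Data.Unit using (⊤; tt)
open import Data.Bool using (if_then_else_)
open import Data.Empty using (⊥; ⊥-elim)
open import Function using (_∘_)
open import Function.Definitions using (Injective)
open import Relation.Binary.Definitions using (tri<; tri≈; tri>)
open import Relation.Nullary using (¬_; Dec; yes; no; does)
open import Relation.Nullary.Decidable using (_×-dec_; ¬¬-excluded-middle)
open import Relation.Binary.PropositionalEquality
  using (_≡_; _≢_; refl; sym; trans; cong; cong₂; subst; subst₂; module ≡-Reasoning)
open import Relation.Binary.Construct.Closure.ReflexiveTransitive using (Star; ε; _◅_)

module Lists {A : Set} where

  all-cut : ∀ {P : A → Set} (xs : List A) {y ys} → All P (xs ++ y ∷ ys) → All P (xs ++ y ∷ [])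
  all-cut []       (py ∷ _)   = py ∷ []
  all-cut (x ∷ xs) (px ∷ pxs) = px ∷ all-cut xs pxs

  unique-cut : ∀ (xs : List A) {y ys} → Unique (xs ++ y ∷ ys) → Unique (xs ++ y ∷ [])
  unique-cut []       (_ ∷ _)   = [] ∷ []
  unique-cut (x ∷ xs) (x∉ ∷ u) = all-cut xs x∉ ∷ unique-cut xs u

  linked-cut : ∀ {R : A → A → Set} (xs : List A) {y ys} → Linked R (xs ++ y ∷ ys) → Linked R (xs ++ y ∷ [])
  linked-cut []           _         = [-]
  linked-cut (x ∷ [])     (r ∷ _)   = r ∷ [-]
  linked-cut (x ∷ x′ ∷ xs) (r ∷ rs) = r ∷ linked-cut (x′ ∷ xs) rs

  linked-∷ʳ : ∀ {R : A → A → Set} (xs : List A) {y z} →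
              Linked R (xs ++ y ∷ []) → R y z → Linked R ((xs ++ y ∷ []) ++ z ∷ [])
  linked-∷ʳ []            _        ryz = ryz ∷ [-]
  linked-∷ʳ (x ∷ [])      (r ∷ _)  ryz = r ∷ ryz ∷ [-]
  linked-∷ʳ (x ∷ x′ ∷ xs) (r ∷ rs) ryz = r ∷ linked-∷ʳ (x′ ∷ xs) rs ryz

  unique-ʳ++ : ∀ (xs : List A) {ys} → Unique xs → Unique ys → (∀ {z} → z ∈ₗ xs → z ∉ₗ ys) → Unique (xs ʳ++ ys)
  unique-ʳ++ []       _          uys _    = uys
  unique-ʳ++ (x ∷ xs) (x∉ ∷ uxs) uys disj =
    unique-ʳ++ xs uxs (¬Any⇒All¬ _ (disj (here refl)) ∷ uys) disj′
    where
    disj′ : ∀ {z} → z ∈ₗ xs → z ∉ₗ x ∷ _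
    disj′ z∈ (here refl) = All.lookup x∉ z∈ refl
    disj′ z∈ (there z∈′) = disj (there z∈) z∈′

  unique-ʳ++-disjoint : ∀ (xs : List A) {ys z} → Unique (xs ʳ++ ys) → z ∈ₗ xs → z ∈ₗ ys → ⊥
  unique-ʳ++-disjoint (x ∷ xs) u (here refl) z∈ys = Unique[x∷xs]⇒x∉xs (unique-suffix xs u) z∈ys
    where
    unique-suffix : ∀ (xs : List A) {ys} → Unique (xs ʳ++ ys) → Unique ys
    unique-suffix []       u = u
    unique-suffix (x ∷ xs) u with unique-suffix xs u
    ... | _ ∷ u′ = u′
  unique-ʳ++-disjoint (x ∷ xs) u (there z∈xs) z∈ys = unique-ʳ++-disjoint xs u z∈xs (there z∈ys)

  linked-ʳ++ : ∀ {R : A → A → Set} → (∀ {a b} → R a b → R b a) →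
               ∀ {x} (xs : List A) {ys} → Linked R (x ∷ xs) → Linked R (x ∷ ys) → Linked R (xs ʳ++ x ∷ ys)
  linked-ʳ++ sym′ []       _          lys = lys
  linked-ʳ++ sym′ (y ∷ xs) (rxy ∷ lxs) lys = linked-ʳ++ sym′ xs lxs (sym′ rxy ∷ lys)

  lastOf-split : ∀ (x : A) xs → ∃ λ init → x ∷ xs ≡ init ++ lastOf x xs ∷ []
  lastOf-split x []       = [] , refl
  lastOf-split x (y ∷ ys) with lastOf-split y ys
  ... | init , eq = x ∷ init , cong (x ∷_) eq

  lastOf-ʳ++ : ∀ (x : A) xs {acc} →
               ∃ λ zs → xs ʳ++ x ∷ acc ≡ lastOf x xs ∷ zs × lastOf (lastOf x xs) zs ≡ lastOf x acc
  lastOf-ʳ++ x []       {acc} = acc , refl , refl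
  lastOf-ʳ++ x (y ∷ xs) {acc} = lastOf-ʳ++ y xs {x ∷ acc}

unique-length : ∀ {n} (xs : List (Fin n)) → Unique xs → length xs ≤ n
unique-length xs u = injective⇒≤ (lookup-injective xs u)
  where
  lookup-injective : ∀ (xs : List (Fin _)) → Unique xs → ∀ {i j} → lookup xs i ≡ lookup xs j → i ≡ j
  lookup-injective (x ∷ xs) u         {fzero}  {fzero}  _  = refl
  lookup-injective (x ∷ xs) (x∉ ∷ _)  {fzero}  {fsuc j} eq = ⊥-elim (All.lookup x∉ (∈-lookup j) eq)
  lookup-injective (x ∷ xs) (x∉ ∷ _)  {fsuc i} {fzero}  eq = ⊥-elim (All.lookup x∉ (∈-lookup i) (sym eq))
  lookup-injective (x ∷ xs) (_ ∷ u)   {fsuc i} {fsuc j} eq = cong fsuc (lookup-injective xs u eq)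

module Paths {n : ℕ} (T : Tree n) where
  open Tree T
  open Lists

  Path : List (Fin n) → Set
  Path = SimplePath graph

  adj-sym : ∀ {u w} → Adj graph u w → Adj graph w u
  adj-sym {u} (p , refl) = symmetric u p

  adj-irrefl : ∀ {u w} → Adj graph u w → w ≢ u
  adj-irrefl {u} (p , refl) = no-loop u p

  path-tail : ∀ {x xs} → Path (x ∷ xs) → Path xs
  path-tail (_ ∷ u , l) = u , Linked.tail l

  path-cut : ∀ xs {y ys} → Path (xs ++ y ∷ ys) → Path (xs ++ y ∷ [])
  path-cut xs (u , l) = unique-cut xs u , linked-cut xs l

  path-length : ∀ {xs} → Path xs → length xs ≤ n
  path-length (u , _) = unique-length _ u

  -- A neighbour w of L can only reappear on a simple path from L as its
  -- second node: otherwise the path up to w, closed by the edge w—L, is a cycle.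
  no-shortcut : ∀ {L w} a A {B} → Path (L ∷ a ∷ A ++ w ∷ B) → Adj graph L w → ⊥
  no-shortcut {L} {w} a A p adj with path-cut (L ∷ a ∷ A) p
  ... | u , l = acyclic L (a ∷ A ++ w ∷ []) (s≤s (nonempty A) , u , linked-∷ʳ (L ∷ a ∷ A) l (adj-sym adj))
    where
    nonempty : ∀ (A : List (Fin n)) → 1 ≤ length (A ++ w ∷ [])
    nonempty []      = s≤s z≤n
    nonempty (_ ∷ _) = s≤s z≤n

  extend : ∀ {L w} rest → Path (L ∷ rest) → Adj graph L w →
           Path (w ∷ L ∷ rest) ⊎ ∃ λ rest′ → rest ≡ w ∷ rest′
  extend {L} {w} rest p@(u , l) adj with member? _≟_ w (L ∷ rest)
  ... | no w∉ = inj₁ (¬Any⇒All¬ _ w∉ ∷ u , adj-sym adj ∷ l)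
  ... | yes (here w≡L) = ⊥-elim (adj-irrefl adj w≡L)
  ... | yes (there w∈) with ∈-∃++ w∈
  ...   | [] , B , refl = inj₂ (B , refl)
  ...   | a ∷ A , B , refl = ⊥-elim (no-shortcut a A p adj)

  Diverging : List (Fin n) → List (Fin n) → Set
  Diverging (q ∷ _) (r ∷ _) = q ≢ r
  Diverging _       _       = ⊤

  glue : ∀ Q {L} rest → Path (L ∷ rest) → Path (L ∷ Q) → Diverging Q rest → Path (Q ʳ++ L ∷ rest)
  glue []      rest p _ _ = p
  glue (q ∷ Q) {L} rest p (L∉ ∷ uQ , Lq ∷ lQ) d with extend rest p Lq
  glue (q ∷ Q) (.q ∷ _) p _ d | inj₂ (_ , refl) = ⊥-elim (d refl)
  ... | inj₁ p′ = glue Q (L ∷ rest) p′ (uQ , lQ) (diverging Q L∉)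
    where
    diverging : ∀ Q → All (L ≢_) (q ∷ Q) → Diverging Q (L ∷ rest)
    diverging []      _             = tt
    diverging (_ ∷ _) (_ ∷ L≢q′ ∷ _) = L≢q′ ∘ sym

  same-start : ∀ {s x} a A b B → Path (s ∷ a ∷ A) → Path (s ∷ b ∷ B) →
               x ∈ₗ a ∷ A → x ∈ₗ b ∷ B → a ≡ b
  same-start a A b B pA pB x∈A x∈B with a ≟ b
  ... | yes a≡b = a≡b
  ... | no  a≢b = ⊥-elim (unique-ʳ++-disjoint (b ∷ B) (proj₁ (glue (b ∷ B) (a ∷ A) pA pB (a≢b ∘ sym)))
                                             x∈B (there x∈A))

  path-unique : ∀ {s x} P Q → Path (s ∷ P ++ x ∷ []) → Path (s ∷ Q ++ x ∷ []) → P ≡ Q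
  path-unique []      []      _  _  = refl
  path-unique []      (b ∷ Q) pP pQ with same-start _ [] b _ pP pQ (here refl) (∈-++⁺ʳ (b ∷ Q) (here refl))
  ... | refl = ⊥-elim (Unique[x∷xs]⇒x∉xs (proj₁ (path-tail pQ)) (∈-++⁺ʳ Q (here refl)))
  path-unique (a ∷ P) []      pP pQ with same-start a _ _ [] pP pQ (∈-++⁺ʳ (a ∷ P) (here refl)) (here refl)
  ... | refl = ⊥-elim (Unique[x∷xs]⇒x∉xs (proj₁ (path-tail pP)) (∈-++⁺ʳ P (here refl)))
  path-unique (a ∷ P) (b ∷ Q) pP pQ
    with same-start a _ b _ pP pQ (∈-++⁺ʳ (a ∷ P) (here refl)) (∈-++⁺ʳ (b ∷ Q) (here refl))
  ... | refl = cong (a ∷_) (path-unique P Q (path-tail pP) (path-tail pQ))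

  -- `TowardAt L v e`: port e of v points toward L.  For v ≠ L this is witnessed
  -- by the (unique) simple path from L to v, whose node before v is nbr v e.
  TowardAt : Fin n → (v : Fin n) → Fin (deg v) → Set
  TowardAt L v e = L ≡ v ⊎ ∃ λ ps → Path (L ∷ ps ++ v ∷ []) × lastOf L ps ≡ nbr v e

  toward-departed : ∀ v p → TowardAt (nbr v p) v p
  toward-departed v p = inj₂ ([] , ((no-loop v p ∷ []) ∷ [] ∷ [] , symmetric v p ∷ [-]) , refl)

  toward-move : ∀ {L w v e} → TowardAt L v e → L ≢ v → Adj graph L w → TowardAt w v e
  toward-move (inj₁ L≡v) L≢v _ = ⊥-elim (L≢v L≡v)
  toward-move {L} {w} {v} {e} (inj₂ (ps , p , last)) _ adj with extend (ps ++ v ∷ []) p adj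
  ... | inj₁ p′ = inj₂ (L ∷ ps , p′ , last)
  ... | inj₂ (rest , eq) = retract ps eq p last
    where
    -- the path from L to v already went through w: drop its first node
    retract : ∀ ps → ps ++ v ∷ [] ≡ w ∷ rest → Path (L ∷ ps ++ v ∷ []) → lastOf L ps ≡ nbr v e →
              TowardAt w v e
    retract []       eq _ _ = inj₁ (sym (proj₁ (∷-injective eq)))
    retract (q ∷ qs) eq p last with ∷-injective eq
    ... | refl , _ = inj₂ (qs , path-tail p , last)

  -- reading the witnessing path backwards gives the statement's PointsToward
  toward⇒pointsToward : ∀ {m L v e} → TowardAt L v e → L ≢ v → PointsToward T {m} v e L
  toward⇒pointsToward (inj₁ L≡v) L≢v = ⊥-elim (L≢v L≡v)
  toward⇒pointsToward {L = L} {v} {e} (inj₂ (ps , (u , l) , last)) _ with lastOf-ʳ++ L ps {[]}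
  ... | zs , split , last-zs = zs , subst Path route reversed , trans (sym last-zs) (cong (λ y → lastOf y zs) last)
    where
    reversed : Path ((ps ++ v ∷ []) ʳ++ L ∷ [])
    reversed = unique-ʳ++ (L ∷ ps ++ v ∷ []) u [] (λ _ ()) , linked-ʳ++ adj-sym (ps ++ v ∷ []) l [-]
    route : (ps ++ v ∷ []) ʳ++ L ∷ [] ≡ v ∷ nbr v e ∷ zs
    route = trans (++-ʳ++ ps) (cong (v ∷_) (trans split (cong (_∷ zs) last)))

  reroot : ∀ {L w x} pre suf → Path (L ∷ pre ++ x ∷ suf) → Adj graph L w → w ≢ x →
           ∃ λ pre′ → Path (w ∷ pre′ ++ x ∷ suf)
  reroot {L} {w} {x} pre suf p adj w≢x with extend (pre ++ x ∷ suf) p adj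
  ... | inj₁ p′ = L ∷ pre , p′
  ... | inj₂ (rest , eq) = retract pre eq (path-tail p)
    where
    retract : ∀ pre → pre ++ x ∷ suf ≡ w ∷ rest → Path (pre ++ x ∷ suf) →
              ∃ λ pre′ → Path (w ∷ pre′ ++ x ∷ suf)
    retract []       eq _ = ⊥-elim (w≢x (sym (proj₁ (∷-injective eq))))
    retract (q ∷ qs) eq p with ∷-injective eq
    ... | refl , _ = qs , p

  retrail : ∀ {L L′ y} pre rest → Path (L ∷ pre ++ y ∷ rest) → L′ ≡ L ⊎ Adj graph L L′ →
            y ≡ L′ ⊎ ∃ λ pre′ → Path (L′ ∷ pre′ ++ y ∷ rest)
  retrail pre rest p (inj₁ refl) = inj₂ (pre , p)
  retrail {L′ = L′} {y} pre rest p (inj₂ adj) with y ≟ L′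
  ... | yes y≡L′ = inj₁ y≡L′
  ... | no  y≢L′ = inj₂ (reroot pre rest p adj (y≢L′ ∘ sym))

  step-back : ∀ {L x e} pre suf → Path (L ∷ pre ++ x ∷ suf) → TowardAt L x e → L ≢ x →
              (nbr x e ≡ L × pre ≡ []) ⊎ ∃ λ pre′ → Path (L ∷ pre′ ++ nbr x e ∷ x ∷ suf)
  step-back pre suf p (inj₁ L≡x) L≢x = ⊥-elim (L≢x L≡x)
  step-back {L} {x} {e} pre suf p (inj₂ (ps , p′ , last)) _
    with path-unique pre ps (path-cut (L ∷ pre) p) p′
  ... | refl = predecessor pre p last
    where
    predecessor : ∀ pre → Path (L ∷ pre ++ x ∷ suf) → lastOf L pre ≡ nbr x e →
                  (nbr x e ≡ L × pre ≡ []) ⊎ ∃ λ pre′ → Path (L ∷ pre′ ++ nbr x e ∷ x ∷ suf)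
    predecessor []       _ last = inj₁ (sym last , refl)
    predecessor (q ∷ qs) p last with lastOf-split q qs
    ... | init , split = inj₂ (init , subst Path (cong (L ∷_) reassoc) p)
      where
      reassoc : (q ∷ qs) ++ x ∷ suf ≡ init ++ nbr x e ∷ x ∷ suf
      reassoc = trans (cong (_++ x ∷ suf) (trans split (cong (λ y → init ++ y ∷ []) last)))
                      (++-assoc init (nbr x e ∷ []) (x ∷ suf))

module Rotor where
  open ≡-Reasoning

  %-absorbˡ : ∀ a b d → (a % suc d + b) % suc d ≡ (a + b) % suc d
  %-absorbˡ a b d = begin
    (a % suc d + b) % suc d               ≡⟨ %-distribˡ-+ (a % suc d) b (suc d) ⟩
    (a % suc d % suc d + b % suc d) % suc d ≡⟨ cong (λ x → (x + b % suc d) % suc d) (m%n%n≡m%n a (suc d)) ⟩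
    (a % suc d + b % suc d) % suc d       ≡⟨ sym (%-distribˡ-+ a b (suc d)) ⟩
    (a + b) % suc d                       ∎

  toℕ-rotate : ∀ {d} (q : Fin (suc d)) k → toℕ (iterate nextPort q k) ≡ (toℕ q + k) % suc d
  toℕ-rotate {d} q zero = begin
    toℕ q               ≡⟨ sym (m≤n⇒m%n≡m (toℕ≤pred[n] q)) ⟩
    toℕ q % suc d       ≡⟨ cong (_% suc d) (sym (+-identityʳ (toℕ q))) ⟩
    (toℕ q + 0) % suc d ∎
  toℕ-rotate {d} q (suc k) = begin
    toℕ (iterate nextPort (nextPort q) k)     ≡⟨ toℕ-rotate (nextPort q) k ⟩
    (toℕ (nextPort q) + k) % suc d            ≡⟨ cong (λ x → (x + k) % suc d) (toℕ-fromℕ< (m%n<n (suc (toℕ q)) (suc d))) ⟩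
    (suc (toℕ q) % suc d + k) % suc d         ≡⟨ %-absorbˡ (suc (toℕ q)) k d ⟩
    (suc (toℕ q) + k) % suc d                 ≡⟨ cong (_% suc d) (sym (+-suc (toℕ q) k)) ⟩
    (toℕ q + suc k) % suc d                   ∎

  port-cover : ∀ {d} (q p : Fin d) → ∃ λ k → k < d × iterate nextPort q (suc k) ≡ p
  port-cover {suc d} q p = k , m%n<n r (suc d) , toℕ-injective (begin
    toℕ (iterate nextPort q (suc k))   ≡⟨ toℕ-rotate q (suc k) ⟩
    (toℕ q + suc k) % suc d            ≡⟨ cong (_% suc d) (trans (+-suc (toℕ q) k) (+-comm (suc (toℕ q)) k)) ⟩
    (r % suc d + suc (toℕ q)) % suc d  ≡⟨ %-absorbˡ r (suc (toℕ q)) d ⟩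
    (r + suc (toℕ q)) % suc d          ≡⟨ cong (_% suc d) (+-assoc (toℕ p) (suc d ∸ suc (toℕ q)) (suc (toℕ q))) ⟩
    (toℕ p + (suc d ∸ suc (toℕ q) + suc (toℕ q))) % suc d
                                       ≡⟨ cong (λ x → (toℕ p + x) % suc d) (m∸n+n≡m (s≤s (toℕ≤pred[n] q))) ⟩
    (toℕ p + suc d) % suc d            ≡⟨ [m+n]%n≡m%n (toℕ p) (suc d) ⟩
    toℕ p % suc d                      ≡⟨ m≤n⇒m%n≡m (toℕ≤pred[n] p) ⟩
    toℕ p                              ∎)
    where
    r k : ℕ
    r = toℕ p + (suc d ∸ suc (toℕ q))
    k = r % suc d

module Time where

  persist-until : ∀ {P : ℕ → Set} {a b} → (∀ t → a ≤ t → t < b → P t → P (suc t)) →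
                  ∀ {t} → a ≤ t → t ≤ b → P a → P t
  persist-until {P} {a} {b} step a≤t t≤b pa = go (≤⇒≤′ a≤t) t≤b
    where
    go : ∀ {t} → a ≤′ t → t ≤ b → P t
    go (_≤′_.≤′-reflexive refl) _   = pa
    go (_≤′_.≤′-step {t} a≤′t) t<b = step t (≤′⇒≤ a≤′t) t<b (go a≤′t (≤-trans (n≤1+n t) t<b))

  persist : ∀ {P : ℕ → Set} → (∀ t → P t → P (suc t)) → ∀ {t s} → t ≤ s → P t → P s
  persist step t≤s = persist-until (λ u _ _ → step u) t≤s ≤-refl

  record First (Q : ℕ → Set) (t : ℕ) : Set where
    field
      time   : ℕ
      from   : t ≤ time
      holds  : Q time
      before : ∀ s → t ≤ s → s < time → ¬ Q s

    earliest : ∀ {s} → t ≤ s → Q s → time ≤ s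
    earliest t≤s qs = ≮⇒≥ (λ s<time → before _ t≤s s<time qs)

  first : ∀ {Q : ℕ → Set} → (∀ s → Dec (Q s)) → ∀ {t s} → t ≤ s → Q s → First Q t
  first {Q} Q? {t} {s} t≤s qs = search (s ∸ t) t (subst Q (sym (m∸n+n≡m t≤s)) qs)
    where
    search : ∀ d t → Q (d + t) → First Q t
    search d t q with Q? t
    ... | yes qt = record { time = t ; from = ≤-refl ; holds = qt
                          ; before = λ s t≤s s<t → ⊥-elim (<-irrefl refl (≤-<-trans t≤s s<t)) }
    search zero    t q | no ¬qt = ⊥-elim (¬qt q)
    search (suc d) t q | no ¬qt = record
      { time = time ; from = ≤-trans (n≤1+n t) from ; holds = holds ; before = before′ }
      where
      open First (search d (suc t) (subst Q (sym (+-suc d t)) q))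
      before′ : ∀ s → t ≤ s → s < time → ¬ Q s
      before′ s t≤s s<time with m≤n⇒m<n∨m≡n t≤s
      ... | inj₁ t<s  = before s t<s s<time
      ... | inj₂ refl = ¬qt

  eventually-all : ∀ {k} (P : Fin k → ℕ → Set) → (∀ i {t s} → t ≤ s → P i t → P i s) →
                   (∀ i → ∃ (P i)) → ∃ λ t → ∀ i → P i t
  eventually-all {zero}  P mono ev = 0 , λ ()
  eventually-all {suc k} P mono ev with ev fzero | eventually-all (P ∘ fsuc) (mono ∘ fsuc) (ev ∘ fsuc)
  ... | t₀ , p₀ | t , ps = t₀ ⊔ t , λ where
    fzero    → mono fzero (m≤m⊔n t₀ t) p₀
    (fsuc i) → mono (fsuc i) (m≤n⊔m t₀ t) (ps i)

module Counting where
  open import Algebra.Properties.CommutativeMonoid.Sum +-0-commutativeMonoid public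
    using (sum; ∑-distrib-+; sum-replicate-zero)

  indicator : ∀ {n} → Fin n → Fin n → ℕ
  indicator u v = if does (u ≟ v) then 1 else 0

  sum-indicator : ∀ {n} (u : Fin n) → sum (indicator u) ≡ 1
  sum-indicator {suc n} fzero    = cong suc (sum-replicate-zero n)
  sum-indicator {suc n} (fsuc u) = sum-indicator u

  sum-bounded : ∀ {n} (f : Fin n → ℕ) K → (∀ v → f v ≤ K) → sum f ≤ n * K
  sum-bounded {zero}  f K _ = z≤n
  sum-bounded {suc n} f K f≤K = +-mono-≤ (f≤K fzero) (sum-bounded (f ∘ fsuc) K (f≤K ∘ fsuc))

  pigeonhole : ∀ {n} (f : Fin n → ℕ) K → n * K < sum f → ∃ λ v → K < f v
  pigeonhole {n} f K big with any? (λ v → K <? f v)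
  ... | yes found = found
  ... | no none   = ⊥-elim (<-irrefl refl (<-≤-trans big (sum-bounded f K (λ v → ≮⇒≥ (λ lt → none (v , lt))))))

module Configurations {n : ℕ} (T : Tree n) {m : ℕ} where
  open Tree T
  open Paths T

  Oriented : Config T m → Fin n → Set
  Oriented c v = TowardAt (leaderPos c) v (edge c v)

  WithLeader : Config T m → Fin m → Set
  WithLeader c i = pos c i ≡ leaderPos c

  -- agent i lies on a simple path from the leader that continues for k more nodes;
  -- k only grows while the agent walks toward the leader, and is bounded by n
  record Behind (c : Config T m) (i : Fin m) (k : ℕ) : Set where
    constructor on-path
    field
      pre suf : List (Fin n)
      path    : Path (leaderPos c ∷ pre ++ pos c i ∷ suf)
      depth   : length suf ≡ k

  behind-apart : ∀ {c i k} → Behind c i k → leaderPos c ≢ pos c i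
  behind-apart (on-path pre suf (L∉ ∷ _ , _) _) L≡x = All.lookup L∉ (∈-++⁺ʳ pre (here L≡x)) refl

  behind-bound : ∀ {c i k} → Behind c i k → k < n
  behind-bound {c} {i} (on-path pre suf p refl) = begin
    suc (length suf)                         ≤⟨ m≤n+m (suc (length suf)) (length pre) ⟩
    length pre + length (pos c i ∷ suf)      ≡⟨ sym (length-++ pre) ⟩
    length (pre ++ pos c i ∷ suf)            ≤⟨ n≤1+n _ ⟩
    length (leaderPos c ∷ pre ++ pos c i ∷ suf) ≤⟨ path-length p ⟩
    n                                        ∎
    where open ≤-Reasoning

  oriented⇒behind : ∀ {c : Config T m} i → Oriented c (pos c i) → ¬ WithLeader c i → Behind c i 0
  oriented⇒behind i (inj₁ L≡x) apart = ⊥-elim (apart (sym L≡x))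
  oriented⇒behind i (inj₂ (ps , p , _)) _ = on-path ps [] p refl

  dest-together : ∀ {c : Config T m} i → leaderPos c ≡ pos c i →
                  dest T c (nonLeader i) ≡ nbr (pos c i) (nextPort (edge c (pos c i)))
  dest-together {c} i eq with leaderPos c ≟ pos c i
  ... | yes _  = refl
  ... | no neq = ⊥-elim (neq eq)

  dest-apart : ∀ {c : Config T m} i → leaderPos c ≢ pos c i → dest T c (nonLeader i) ≡ nbr (pos c i) (edge c (pos c i))
  dest-apart {c} i neq with leaderPos c ≟ pos c i
  ... | yes eq = ⊥-elim (neq eq)
  ... | no _   = refl

  module OneStep {c c′ : Config T m} {S : Subset n} {rk : Fin m → ℕ} (step : Step T c S rk c′) where
    active-moves : ∀ a → at T c a ∈ S → at T c′ a ≡ dest T c a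
    active-moves = proj₁ step

    idle-stays : ∀ a → at T c a ∉ S → at T c′ a ≡ at T c a
    idle-stays = proj₁ (proj₂ step)

    edge-advances : leaderPos c ∈ S → edge c′ (leaderPos c) ≡ nextPort (edge c (leaderPos c))
    edge-advances L∈S = proj₁ (proj₂ (proj₂ step)) _ L∈S refl

    edge-kept : ∀ v → ¬ (v ∈ S × leaderPos c ≡ v) → edge c′ v ≡ edge c v
    edge-kept = proj₁ (proj₂ (proj₂ (proj₂ step)))

    fresh : ∀ i → Renames T c S rk i → Fresh T c c′ i (ident c′ i)
    fresh = proj₁ (proj₂ (proj₂ (proj₂ (proj₂ step))))

    id-kept : ∀ i → ¬ Renames T c S rk i → ident c′ i ≡ ident c i
    id-kept = proj₂ (proj₂ (proj₂ (proj₂ (proj₂ step))))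

    leader-moves : leaderPos c ∈ S → leaderPos c′ ≡ nbr (leaderPos c) (nextPort (edge c (leaderPos c)))
    leader-moves = active-moves leader

    leader-stays : leaderPos c ∉ S → leaderPos c′ ≡ leaderPos c
    leader-stays = idle-stays leader

    leader-step : leaderPos c′ ≡ leaderPos c ⊎ Adj graph (leaderPos c) (leaderPos c′)
    leader-step with leaderPos c ∈? S
    ... | yes L∈S = inj₂ (_ , sym (leader-moves L∈S))
    ... | no  L∉S = inj₁ (leader-stays L∉S)

    oriented-step : ∀ v → Oriented c v → Oriented c′ v
    oriented-step v o with leaderPos c ∈? S
    ... | no L∉S = subst₂ (λ L e → TowardAt L v e) (sym (leader-stays L∉S))
                     (sym (edge-kept v λ (v∈S , L≡v) → L∉S (subst (_∈ S) (sym L≡v) v∈S))) o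
    ... | yes L∈S with leaderPos c ≟ v
    ...   | yes refl = subst₂ (λ L e → TowardAt L v e) (sym (leader-moves L∈S)) (sym (edge-advances L∈S))
                         (toward-departed v _)
    ...   | no  L≢v  = subst₂ (λ L e → TowardAt L v e) (sym (leader-moves L∈S)) (sym (edge-kept v (L≢v ∘ proj₂)))
                         (toward-move o L≢v (_ , refl))

    with-leader-step : ∀ i → WithLeader c i → WithLeader c′ i
    with-leader-step i together with leaderPos c ∈? S
    ... | yes L∈S = begin
      pos c′ i                                     ≡⟨ active-moves (nonLeader i) (subst (_∈ S) (sym together) L∈S) ⟩
      dest T c (nonLeader i)                       ≡⟨ dest-together i (sym together) ⟩
      nbr (pos c i) (nextPort (edge c (pos c i)))  ≡⟨ cong (λ x → nbr x (nextPort (edge c x))) together ⟩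
      nbr (leaderPos c) (nextPort (edge c (leaderPos c))) ≡⟨ sym (leader-moves L∈S) ⟩
      leaderPos c′                                 ∎
      where open ≡-Reasoning
    ... | no L∉S = trans (idle-stays (nonLeader i) (L∉S ∘ subst (_∈ S) together))
                         (trans together (sym (leader-stays L∉S)))

    follows-edge : ∀ i → pos c i ∈ S → leaderPos c ≢ pos c i → pos c′ i ≡ nbr (pos c i) (edge c (pos c i))
    follows-edge i x∈S apart = trans (active-moves (nonLeader i) x∈S) (dest-apart i apart)

    behind-idle : ∀ i {k} → pos c i ∉ S → Behind c i k → WithLeader c′ i ⊎ Behind c′ i k
    behind-idle i x∉S (on-path pre suf p len) with retrail pre suf p leader-step
    ... | inj₁ x≡L′ = inj₁ (trans (idle-stays (nonLeader i) x∉S) x≡L′)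
    ... | inj₂ (pre′ , p′) = inj₂ (on-path pre′ suf (subst (λ x → Path (leaderPos c′ ∷ pre′ ++ x ∷ suf))
                                                       (sym (idle-stays (nonLeader i) x∉S)) p′) len)

    -- Half-duplex links forbid it to swap places with the leader.
    behind-active : ∀ i {k} → pos c i ∈ S → ValidChoice T c S → Oriented c (pos c i) →
                    Behind c i k → WithLeader c′ i ⊎ Behind c′ i (suc k)
    behind-active i x∈S (_ , _ , half-duplex) o b@(on-path pre suf p len)
      with follows-edge i x∈S (behind-apart b) | step-back pre suf p o (behind-apart b)
    ... | moved | inj₂ (pre′ , p′) with retrail pre′ (pos c i ∷ suf) p′ leader-step
    ...   | inj₁ y≡L′ = inj₁ (trans moved y≡L′)
    ...   | inj₂ (pre″ , p″) = inj₂ (on-path pre″ (pos c i ∷ suf)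
              (subst (λ y → Path (leaderPos c′ ∷ pre″ ++ y ∷ pos c i ∷ suf)) (sym moved) p″) (cong suc len))
    behind-active i x∈S (_ , _ , half-duplex) o b@(on-path .[] suf p len)
      | moved | inj₁ (y≡L , refl) with leaderPos c ∈? S
    ... | no L∉S = inj₁ (trans moved (trans y≡L (sym (leader-stays L∉S))))
    ... | yes L∈S with extend (pos c i ∷ suf) p (_ , refl)
    ...   | inj₁ p′ = inj₂ (on-path [] (pos c i ∷ suf) (subst₂ (λ L′ y → Path (L′ ∷ y ∷ pos c i ∷ suf))
                              (sym (leader-moves L∈S)) (sym (trans moved y≡L)) p′) (cong suc len))
    ...   | inj₂ (_ , x≡w) = ⊥-elim (half-duplex leader (nonLeader i) (leaderPos c) (pos c i)
                                (refl , L∈S , sym (proj₁ (∷-injective x≡w)))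
                                (refl , x∈S , trans (dest-apart i (behind-apart b)) y≡L))

    -- If all agents are with the leader, every node is oriented and the leader's
    -- node is activated, the next configuration is legitimate: everybody leaves
    -- through the same port, and of two agents sharing an identifier the one
    -- executed first renames itself to a fresh identifier.
    legitimate-next : leaderPos c ∈ S → (∀ i → WithLeader c i) → (∀ v → Oriented c v) →
                      Injective _≡_ _≡_ rk → Legitimate T c′
    legitimate-next L∈S together oriented rk-injective = distinct , leaderPos c′ , gathered , pointing
      where
      gathered : ∀ a → at T c′ a ≡ leaderPos c′
      gathered leader        = refl
      gathered (nonLeader i) = with-leader-step i (together i)

      pointing : ∀ v → v ≢ leaderPos c′ → PointsToward T {m} v (edge c′ v) (leaderPos c′)
      pointing v v≢L = toward⇒pointsToward {m} (oriented-step v (oriented v)) (v≢L ∘ sym)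

      renames : ∀ i j → j ≢ i → rk i < rk j → ident c j ≡ ident c i → Renames T c S rk i
      renames i j j≢i i<j same = subst (_∈ S) (sym (together i)) L∈S , sym (together i) ,
                                 j , j≢i , trans (together j) (sym (together i)) , i<j , same

      kept-distinct : ∀ i j → i ≢ j → ident c i ≡ ident c j →
                      ¬ Renames T c S rk i → ¬ Renames T c S rk j → ⊥
      kept-distinct i j i≢j same keep-i keep-j with <-cmp (rk i) (rk j)
      ... | tri< i<j _ _ = keep-i (renames i j (i≢j ∘ sym) i<j (sym same))
      ... | tri≈ _ eq _  = i≢j (rk-injective eq)
      ... | tri> _ _ j<i = keep-j (renames j i i≢j j<i same)

      distinct : ∀ i j → i ≢ j → ident c′ i ≢ ident c′ j
      distinct i j i≢j same = ¬¬-excluded-middle λ where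
        (yes ren-i) → proj₂ (fresh i ren-i j (i≢j ∘ sym)) same
        (no keep-i) → ¬¬-excluded-middle λ where
          (yes ren-j) → proj₂ (fresh j ren-j i i≢j) (sym same)
          (no keep-j) → kept-distinct i j i≢j
                          (trans (sym (id-kept i keep-i)) (trans same (id-kept j keep-j))) keep-i keep-j

module Executions {n : ℕ} {T : Tree n} {m : ℕ} (E : Execution T {m}) where
  open Tree T
  open Paths T
  open Configurations T {m}
  open Execution E
  open Time
  open Counting
  private module At t = OneStep (step t)

  oriented-later : ∀ v {t s} → t ≤ s → Oriented (config t) v → Oriented (config s) v
  oriented-later v = persist (λ t → At.oriented-step t v)

  with-leader-later : ∀ i {t s} → t ≤ s → WithLeader (config t) i → WithLeader (config s) i
  with-leader-later i = persist (λ t → At.with-leader-step t i)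

  first-activation : ∀ t v → Hosts T (config t) v → First (λ s → v ∈ sched s) t
  first-activation t v hosts with fair t v hosts
  ... | t′ , t≤t′ , active = first (λ s → v ∈? sched s) t≤t′ active

  leader-waits : ∀ {a b w} → leaderPos (config a) ≡ w → (∀ t → a ≤ t → t < b → w ∉ sched t) →
                 ∀ {t} → a ≤ t → t ≤ b → leaderPos (config t) ≡ w
  leader-waits {a} {b} {w} at-w idle a≤t t≤b = persist-until stays a≤t t≤b at-w
    where
    stays : ∀ t → a ≤ t → t < b → leaderPos (config t) ≡ w → leaderPos (config (suc t)) ≡ w
    stays t a≤t t<b L≡w = trans (At.leader-stays t (subst (_∉ sched t) (sym L≡w) (idle t a≤t t<b))) L≡w

  leader-activated : ∀ t → ∃ λ j → t ≤ j × leaderPos (config j) ∈ sched j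
  leader-activated t with first-activation t (leaderPos (config t)) (leader , refl)
  ... | f = time , from , subst (_∈ sched time) (sym (leader-waits refl before from ≤-refl)) holds
    where open First f

  Departs : Fin n → ℕ → Set
  Departs v t = leaderPos (config t) ≡ v × v ∈ sched t

  departs? : ∀ v t → Dec (Departs v t)
  departs? v t = (leaderPos (config t) ≟ v) ×-dec (v ∈? sched t)

  edge-departure : ∀ {v t} → Departs v t → edge (config (suc t)) v ≡ nextPort (edge (config t) v)
  edge-departure {t = t} (refl , active) = At.edge-advances t active

  leader-departure : ∀ {v t} → Departs v t → leaderPos (config (suc t)) ≡ nbr v (edge (config (suc t)) v)
  leader-departure {t = t} d@(refl , active) =
    trans (At.leader-moves t active) (cong (nbr _) (sym (edge-departure d)))

  edge-quiet : ∀ {v t} → ¬ Departs v t → edge (config (suc t)) v ≡ edge (config t) v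
  edge-quiet {v} {t} ¬d = At.edge-kept t v (λ (active , L≡v) → ¬d (L≡v , active))

  Departures : Fin n → ℕ → ℕ → Set
  Departures v zero    s = ⊤
  Departures v (suc K) s = ∃ λ t → s ≤ t × Departs v t × Departures v K (suc t)

  departures-fewer : ∀ {v K K′ s} → K′ ≤ K → Departures v K s → Departures v K′ s
  departures-fewer {K′ = zero}  _         _                = tt
  departures-fewer {K′ = suc _} (s≤s K′≤K) (t , s≤t , d , ds) = t , s≤t , d , departures-fewer K′≤K ds

  departures-earlier : ∀ {v K s s′} → s′ ≤ s → Departures v K s → Departures v K s′
  departures-earlier {K = zero}  _    _                = tt
  departures-earlier {K = suc _} s′≤s (t , s≤t , d , ds) = t , ≤-trans s′≤s s≤t , d , ds

  departures-skip : ∀ {v K a b} → (∀ t → a ≤ t → t < b → ¬ Departs v t) → Departures v K a → Departures v K b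
  departures-skip {K = zero}  _     _                = tt
  departures-skip {K = suc _} quiet (t , a≤t , d , ds) = t , ≮⇒≥ (λ t<b → quiet t a≤t t<b d) , d , ds

  first-departure : ∀ {v K s} → Departures v (suc K) s →
                    ∃ λ t → s ≤ t × Departs v t × edge (config t) v ≡ edge (config s) v × Departures v K (suc t)
  first-departure {v} {s = s} (t₀ , s≤t₀ , d₀ , ds) =
    time , from , holds , persist-until unchanged from ≤-refl refl , departures-earlier (s≤s (earliest s≤t₀ d₀)) ds
    where
    open First (first (departs? v) s≤t₀ d₀)
    unchanged : ∀ t → s ≤ t → t < time →
                edge (config t) v ≡ edge (config s) v → edge (config (suc t)) v ≡ edge (config s) v
    unchanged t s≤t t<time e = trans (edge-quiet (before t s≤t t<time)) e

  rotation : ∀ v k R {s} → Departures v (suc k + R) s →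
             ∃ λ t → s ≤ t × Departs v t × edge (config (suc t)) v ≡ iterate nextPort (edge (config s) v) (suc k)
                   × Departures v R (suc t)
  rotation v zero R dep with first-departure dep
  ... | t , s≤t , d , e , ds = t , s≤t , d , trans (edge-departure d) (cong nextPort e) , ds
  rotation v (suc k) R dep with first-departure dep
  ... | t , s≤t , d , e , ds with rotation v k R ds
  ...   | t′ , t<t′ , d′ , e′ , ds′ =
          t′ , ≤-trans s≤t (≤-trans (n≤1+n t) t<t′) , d′ ,
          trans e′ (cong (λ q → iterate nextPort q (suc k)) (trans (edge-departure d) (cong nextPort e))) , ds′

  visits-neighbour : ∀ v p R {s} → Departures v (deg v + R) s →
                     ∃ λ t → s ≤ t × leaderPos (config (suc t)) ≡ nbr v p × Departures v R (suc t)
  visits-neighbour v p R {s} dep with Rotor.port-cover (edge (config s) v) p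
  ... | k , k<deg , reaches-p with rotation v k R (departures-fewer (+-monoˡ-≤ R k<deg) dep)
  ...   | t , s≤t , d , e , ds = t , s≤t , trans (leader-departure d) (cong (nbr v) (trans e reaches-p)) , ds

  -- Having arrived at w = nbr v p at time t + 1, the leader waits at w until w
  -- is activated, so it departs from w before it can depart from v again.
  wait-and-depart : ∀ v p {t K} → leaderPos (config (suc t)) ≡ nbr v p → Departures v K (suc t) →
                    ∃ λ j → suc t ≤ j × Departs (nbr v p) j × Departures v K (suc j)
  wait-and-depart v p {t} at-w ds = time , from , (waits from ≤-refl , holds) , departures-skip away ds
    where
    open First (first-activation (suc t) (nbr v p) (leader , at-w))
    waits : ∀ {u} → suc t ≤ u → u ≤ time → leaderPos (config u) ≡ nbr v p
    waits = leader-waits at-w before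
    away : ∀ u → suc t ≤ u → u < suc time → ¬ Departs v u
    away u t<u (s≤s u≤time) (L≡v , _) = no-loop v p (trans (sym (waits t<u u≤time)) L≡v)

  spread : ∀ v p K {s} → Departures v (K * deg v) s → Departures (nbr v p) K s
  spread v p zero    _   = tt
  spread v p (suc K) dep =
    let t , s≤t , at-w , ds  = visits-neighbour v p (K * deg v) dep
        j , t<j , d , ds′    = wait-and-depart v p at-w ds
    in  j , ≤-trans s≤t (≤-trans (n≤1+n t) t<j) , d , spread v p K ds′

  -- the number of departures from v that force one departure from u along a walk
  cost : ∀ {v u} → Star (Adj graph) v u → ℕ
  cost ε                = 1
  cost {v} (_ ◅ walk) = cost walk * deg v

  spread-along : ∀ {v u} (walk : Star (Adj graph) v u) {s} → Departures v (cost walk) s → Departures u 1 s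
  spread-along ε                    dep = dep
  spread-along {v} ((p , refl) ◅ walk) dep = spread-along walk (spread v p (cost walk) dep)

  tally : ∀ N s → ∃ λ f → sum f ≡ N × ∀ v → Departures v (f v) s
  tally zero    s = (λ _ → 0) , sum-replicate-zero n , λ _ → tt
  tally (suc N) s with leader-activated s
  ... | j , s≤j , active with tally N (suc j)
  ...   | f , total , ds = (λ v → indicator u v + f v) , counted , departures
    where
    u : Fin n
    u = leaderPos (config j)
    counted : sum (λ v → indicator u v + f v) ≡ suc N
    counted = trans (∑-distrib-+ (indicator u) f) (cong₂ _+_ (sum-indicator u) total)
    departures : ∀ v → Departures v (indicator u v + f v) s
    departures v with u ≟ v
    ... | yes refl = j , s≤j , (refl , active) , ds u
    ... | no  _    = departures-earlier (≤-trans s≤j (n≤1+n j)) (ds v)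

  departs-often : ∀ K → ∃ λ v → Departures v K 0
  departs-often K =
    let f , total , ds = tally (suc (n * K)) 0
        v , K<fv       = pigeonhole f K (subst (n * K <_) (sym total) ≤-refl)
    in  v , departures-fewer (≤-trans (n≤1+n K) K<fv) (ds v)

  leader-visits : ∀ u → ∃ λ t → leaderPos (config t) ≡ u
  leader-visits u =
    let K , enough         = eventually-all (λ v K → cost (connected v u) ≤ K) (λ _ K≤K′ c≤K → ≤-trans c≤K K≤K′)
                                            (λ v → cost (connected v u) , ≤-refl)
        v , dep            = departs-often K
        t , _ , (at-u , _) , _ = spread-along (connected v u) (departures-fewer (enough v) dep)
    in  t , at-u

  eventually-oriented : ∃ λ t → ∀ v → Oriented (config t) v
  eventually-oriented = eventually-all (λ v t → Oriented (config t) v) oriented-later visited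
    where
    visited : ∀ v → ∃ λ t → Oriented (config t) v
    visited v = let t , at-v = leader-visits v in t , inj₁ at-v

  Waiting : Fin m → ℕ → Fin n → ℕ → Set
  Waiting i k x t = WithLeader (config t) i ⊎ (Behind (config t) i k × pos (config t) i ≡ x)

  wait-behind : ∀ i {k a b} → Behind (config a) i k → (∀ t → a ≤ t → t < b → pos (config a) i ∉ sched t) →
                a ≤ b → Waiting i k (pos (config a) i) b
  wait-behind i {k} {a} {b} behind idle a≤b = persist-until keep a≤b ≤-refl (inj₂ (behind , refl))
    where
    keep : ∀ t → a ≤ t → t < b → Waiting i k (pos (config a) i) t → Waiting i k (pos (config a) i) (suc t)
    keep t _   _   (inj₁ together)        = inj₁ (At.with-leader-step t i together)
    keep t a≤t t<b (inj₂ (behind , same)) =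
      let x∉ = subst (_∉ sched t) (sym same) (idle t a≤t t<b)
      in  Sum.map₂ (λ behind′ → behind′ , trans (At.idle-stays t (nonLeader i) x∉) same)
                   (At.behind-idle t i x∉ behind)

  catch-up-step : ∀ {t₀} → (∀ v → Oriented (config t₀) v) → ∀ i {k t} → t₀ ≤ t → Behind (config t) i k →
                  (∃ λ s → WithLeader (config s) i) ⊎ (∃ λ t′ → t ≤ t′ × Behind (config t′) i (suc k))
  catch-up-step oriented i {t = t} t₀≤t behind with first-activation t (pos (config t) i) (nonLeader i , refl)
  ... | record { time = j ; from = t≤j ; holds = active ; before = idle } with wait-behind i behind idle t≤j
  ...   | inj₁ together = inj₁ (j , together)
  ...   | inj₂ (behind′ , same)
          with At.behind-active j i (subst (_∈ sched j) (sym same) active) (valid j)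
                                (oriented-later _ (≤-trans t₀≤t t≤j) (oriented _)) behind′
  ...     | inj₁ together = inj₁ (suc j , together)
  ...     | inj₂ behind″  = inj₂ (suc j , ≤-trans t≤j (n≤1+n j) , behind″)

  -- as an agent can be at most n - 1 behind, it eventually joins the leader
  chase : ∀ {t₀} → (∀ v → Oriented (config t₀) v) → ∀ i fuel {k t} → t₀ ≤ t → n ≤ k + fuel →
          Behind (config t) i k → ∃ λ s → WithLeader (config s) i
  chase _ i zero {k} _ n≤k behind = ⊥-elim (<⇒≱ (behind-bound behind) (subst (n ≤_) (+-identityʳ k) n≤k))
  chase oriented i (suc fuel) {k} t₀≤t n≤ behind with catch-up-step oriented i t₀≤t behind
  ... | inj₁ joined = joined
  ... | inj₂ (t′ , t≤t′ , behind′) =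
        chase oriented i fuel (≤-trans t₀≤t t≤t′) (subst (n ≤_) (+-suc k fuel) n≤) behind′

  joins : ∀ {t₀} → (∀ v → Oriented (config t₀) v) → ∀ i → ∃ λ t → WithLeader (config t) i
  joins {t₀} oriented i with pos (config t₀) i ≟ leaderPos (config t₀)
  ... | yes together = t₀ , together
  ... | no  apart    = chase oriented i n ≤-refl ≤-refl (oriented⇒behind {config t₀} i (oriented _) apart)

  legitimate-after : ∀ t → (∀ i → WithLeader (config t) i) → (∀ v → Oriented (config t) v) →
                     ∃ λ s → Legitimate T (config s)
  legitimate-after t together oriented =
    let j , t≤j , active = leader-activated t
    in  suc j , At.legitimate-next j active (λ i → with-leader-later i t≤j (together i))
                                            (λ v → oriented-later v t≤j (oriented v)) (rank-inj j)

mainTheorem10 : ∀ (n : ℕ) (T : Tree n) (m : ℕ) (E : Execution T {m})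
                → ∃ λ t → Legitimate T (Execution.config E t)
mainTheorem10 n T m E =
  let t₀ , oriented = eventually-oriented
      t₁ , together = eventually-all (λ i t → WithLeader (config t) i) with-leader-later (joins oriented)
  in  legitimate-after (t₀ ⊔ t₁) (λ i → with-leader-later i (m≤n⊔m t₀ t₁) (together i))
                                 (λ v → oriented-later v (m≤m⊔n t₀ t₁) (oriented v))
  where
  open Execution E
  open Configurations T
  open Executions E
  open Time using (eventually-all)
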